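{- Let $n\ge 4$ and $\alpha\in\{0,1\}$. Then (1) $|\mathcal{PSC}_n^{\alpha,1}|=2^{n-2}$; (2) $|\mathcal{PSC}_n^{1,0}|=2^{n-2}$ if $n$ is odd, and $|\mathcal{PSC}_n^{1,0}|=2^{n-2}-2^{\frac{n-2}{2}}$ if $n$ is even; (3) $|\mathcal{PSC}_n^{0,0}|=2^{n-2}-2^{\lfloor\frac{n-1}{2}\rfloor}$.
   Context: For $n\ge 3$, let $C_n$ be the set of $n\times n$ real matrices $A$ whose first $n-1$ rows are fixed, row $i$ ($1\le i\le n-1$) having a single entry $1$ in column $i+1$ and zeros elsewhere, and whose last row is $(a_{n,1},\dots,a_{n,n})$ with every $a_{n,j}\in\{0,1\}$ (companion matrices with $(0,1)$ last row). For $A\in C_n$ put $F(A)=A+A^T$ (a "symmetric companion matrix"). For $\alpha,\mathbf e\in\{0,1\}$ let $C_n^{\alpha,\mathbf e}=\{F(A): A\in C_n,\ a_{n,1}=\alpha,\ a_{n,n}=\mathbf e\}$ and let $\mathcal{PSC}_n^{\alpha,\mathbf e}$ be the set of primitive matrices in $C_n^{\alpha,\mathbf e}$. A nonnegative square matrix $B$ is primitive if $B^k$ is entrywise positive for some positive integer $k$. -}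

module Defs where

open import Data.Nat using (ℕ; zero; suc; _+_; _*_; _<_; _≤_; _≟_)
open import Data.Fin using (Fin; toℕ)
open import Data.Vec using (Vec; lookup; tabulate; sum)
open import Data.Vec.Relation.Unary.All using (All)
open import Data.List using (List; length)
open import Data.List.Relation.Unary.Unique.Propositional using (Unique)
open import Data.List.Membership.Propositional using (_∈_)
open import Data.Product using (Σ; ∃; _×_)
open import Data.Sum using (_⊎_)
open import Relation.Nullary.Decidable using (⌊_⌋)
open import Data.Bool using (if_then_else_)
open import Relation.Binary.PropositionalEquality using (_≡_)
open import Function.Bundles using (_⇔_)

Mat : ℕ → Set
Mat n = Vec (Vec ℕ n) n

entry : ∀ {n} → Mat n → Fin n → Fin n → ℕ
entry A i j = lookup (lookup A i) j

_⊗_ : ∀ {n} → Mat n → Mat n → Mat n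
_⊗_ {n} A B = tabulate λ i → tabulate λ j → sum (tabulate {n = n} λ k → entry A i k * entry B k j)

identity : ∀ {n} → Mat n
identity = tabulate λ i → tabulate λ j → if ⌊ toℕ i ≟ toℕ j ⌋ then 1 else 0

pow : ∀ {n} → Mat n → ℕ → Mat n
pow A zero = identity
pow A (suc k) = A ⊗ pow A k

-- Primitive: some positive power is entrywise positive (nonnegativity is
-- automatic for ℕ entries).
Primitive : ∀ {n} → Mat n → Set
Primitive {n} B = Σ ℕ λ k → 1 ≤ k × (∀ i j → 0 < entry (pow B k) i j)

companion : ∀ {n} → Vec ℕ n → Mat n
companion {n} r = tabulate λ i → tabulate λ j →
  if ⌊ suc (toℕ i) ≟ n ⌋ then lookup r j
  else (if ⌊ toℕ j ≟ suc (toℕ i) ⌋ then 1 else 0)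

F : ∀ {n} → Mat n → Mat n
F A = tabulate λ i → tabulate λ j → entry A i j + entry A j i

Is01 : ℕ → Set
Is01 x = x ≡ 0 ⊎ x ≡ 1

-- B ∈ C_n^{α,e}: B = F(A) for a companion matrix A with (0,1) last row r,
-- a_{n,1} = r[first] = α and a_{n,n} = r[last] = e.
InC : (n α e : ℕ) → Mat n → Set
InC n α e B = Σ (Vec ℕ n) λ r →
  All Is01 r
  × (∀ (i : Fin n) → toℕ i ≡ 0 → lookup r i ≡ α)
  × (∀ (i : Fin n) → suc (toℕ i) ≡ n → lookup r i ≡ e)
  × B ≡ F (companion r)

InPSC : (n α e : ℕ) → Mat n → Set
InPSC n α e B = InC n α e B × Primitive B

HasCard : {A : Set} → (A → Set) → ℕ → Set
HasCard {A} P m = Σ (List A) λ xs →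
  length xs ≡ m × Unique xs × (∀ x → P x ⇔ x ∈ xs)

-- F(A) is the adjacency matrix of the graph on the vertices 0, …, n-1 formed by the path
-- 0 — 1 — ⋯ — n-1 and an edge from n-1 to every j with a_{n,j+1} = 1, which closes a cycle
-- of length n - j.  If one of these cycles is odd, every vertex reaches n-1 and can wind
-- around an odd or an even closed walk there, so some power of F(A) is positive.  If all of
-- them are even, every edge joins indices of opposite parity, so walks from 0 to 0 and
-- from 0 to 1 have lengths of different parity.  Hence F(A) is primitive iff a_{n,j+1} = 1
-- for some j with n-1-j even.  For counting: if a_{n,n} = 1 the loop at n-1 is such a j;
-- if α = 1 and n is odd, j = 0 is one; otherwise the excluded rows vanish at every
-- j ∈ {1, …, n-2} with n-1-j even and are arbitrary at the ⌊(n-1)/2⌋ other positions.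
module Submission where

open import Defs
open import Data.Nat using (ℕ; zero; suc; _+_; _*_; _∸_; _^_; _≤_; _<_; _/_; _%_; ⌊_/2⌋; ⌈_/2⌉; z≤n; s≤s; z<s; parity)
open import Data.Nat.Properties
open import Data.Nat.DivMod using (m/n≡1+[m∸n]/n)
open import Data.Parity.Base using (Parity; 0ℙ; 1ℙ; _⁻¹) renaming (_+_ to _+ℙ_)
open import Data.Parity.Properties using (p+p≡0ℙ; p+p⁻¹≡1ℙ; ⁻¹-selfInverse; suc-homo-⁻¹; +-homo-+)
import Data.Parity.Properties as ℙ
open import Data.Fin using (Fin; zero; suc; toℕ; fromℕ)
open import Data.Fin.Properties using (toℕ-fromℕ; toℕ-fromℕ<; toℕ-injective; toℕ<n; any?)
open import Data.Vec using (Vec; []; _∷_; lookup; tabulate; sum)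
open import Data.Vec.Properties using (lookup∘tabulate; tabulate∘lookup; tabulate-cong; ∷-injectiveˡ; ∷-injectiveʳ)
open import Data.Vec.Relation.Unary.All using (All; []; _∷_)
open import Data.Vec.Relation.Unary.All.Properties using (lookup⁺)
open import Data.List using (List; []; _++_; map; length; [_])
open import Data.List.Properties using (length-++; length-map)
open import Data.List.Membership.Propositional using (_∈_)
open import Data.List.Membership.Propositional.Properties using (∈-map⁺; ∈-map⁻; ∈-++⁺ˡ; ∈-++⁺ʳ; ∈-++⁻)
open import Data.List.Relation.Unary.Any using (here)
open import Data.List.Relation.Unary.Unique.Propositional using (Unique)
open import Data.List.Relation.Unary.AllPairs using ([]; _∷_)
import Data.List.Relation.Unary.Unique.Propositional.Properties as Unique
import Data.List.Relation.Unary.All as ListAll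
open import Data.Product using (∃; _×_; _,_)
open import Data.Sum using (_⊎_; inj₁; inj₂)
open import Data.Bool using (if_then_else_)
open import Relation.Nullary using (¬_; Dec; yes; no; contradiction; _×-dec_)
open import Relation.Nullary.Decidable using (⌊_⌋)
open import Relation.Binary.PropositionalEquality hiding ([_])
open import Function.Bundles using (_⇔_; mk⇔; module Equivalence)
open import Data.Nat.Tactic.RingSolver using (solve-∀)
open import Algebra.Properties.CommutativeSemigroup +-commutativeSemigroup using (x∙yz≈y∙xz)

entry-tabulate : ∀ {n} (f : Fin n → Fin n → ℕ) i j →
                 entry (tabulate λ i → tabulate (f i)) i j ≡ f i j
entry-tabulate f i j =
  trans (cong (λ row → lookup row j) (lookup∘tabulate _ i)) (lookup∘tabulate (f i) j)

sum-pos⁺ : ∀ {m} (v : Vec ℕ m) k → 0 < lookup v k → 0 < sum v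
sum-pos⁺ (x ∷ v) zero    p = ≤-trans p (m≤m+n x (sum v))
sum-pos⁺ (x ∷ v) (suc k) p = ≤-trans (sum-pos⁺ v k p) (m≤n+m (sum v) x)

sum-pos⁻ : ∀ {m} (v : Vec ℕ m) → 0 < sum v → ∃ λ k → 0 < lookup v k
sum-pos⁻ (zero  ∷ v) p = let k , q = sum-pos⁻ v p in suc k , q
sum-pos⁻ (suc x ∷ v) p = zero , z<s

*-pos⁻ : ∀ a b → 0 < a * b → 0 < a × 0 < b
*-pos⁻ (suc a) (suc b) _ = z<s , z<s
*-pos⁻ (suc a) zero    p = contradiction (subst (0 <_) (*-zeroʳ a) p) (<-irrefl refl)

+-pos⁻ : ∀ a b → 0 < a + b → 0 < a ⊎ 0 < b
+-pos⁻ zero    b p = inj₂ p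
+-pos⁻ (suc a) b p = inj₁ z<s

Edge : ∀ {n} → Mat n → Fin n → Fin n → Set
Edge B i j = 0 < entry B i j

data Walk {n} (B : Mat n) : ℕ → Fin n → Fin n → Set where
  []  : ∀ {i} → Walk B 0 i i
  _∷_ : ∀ {k i l j} → Edge B i l → Walk B k l j → Walk B (suc k) i j

module _ {n} {B : Mat n} where

  infixr 5 _++ʷ_
  _++ʷ_ : ∀ {a b i l j} → Walk B a i l → Walk B b l j → Walk B (a + b) i j
  []      ++ʷ w = w
  (e ∷ v) ++ʷ w = e ∷ (v ++ʷ w)

  _∷ʳʷ_ : ∀ {k i l j} → Walk B k i l → Edge B l j → Walk B (suc k) i j
  []      ∷ʳʷ e = e ∷ []
  (e ∷ w) ∷ʳʷ f = e ∷ (w ∷ʳʷ f)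

  reverseʷ : (∀ i j → Edge B i j → Edge B j i) → ∀ {k i j} → Walk B k i j → Walk B k j i
  reverseʷ sym-B []                      = []
  reverseʷ sym-B (_∷_ {i = i} {l} e w) = reverseʷ sym-B w ∷ʳʷ sym-B i l e

  entry-⊗ : ∀ (C : Mat n) i j → entry (B ⊗ C) i j ≡ sum (tabulate λ l → entry B i l * entry C l j)
  entry-⊗ C = entry-tabulate λ i j → sum (tabulate λ l → entry B i l * entry C l j)

  private
    terms : ℕ → Fin n → Fin n → Vec ℕ n
    terms k i j = tabulate λ l → entry B i l * entry (pow B k) l j

  walk⇒pow-pos : ∀ {k i j} → Walk B k i j → 0 < entry (pow B k) i j
  walk⇒pow-pos {i = i} [] = subst (0 <_) (sym (entry-tabulate _ i i)) (diagonal (toℕ i ≟ toℕ i))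
    where
    diagonal : (d : Dec (toℕ i ≡ toℕ i)) → 0 < (if ⌊ d ⌋ then 1 else 0)
    diagonal (yes _)  = z<s
    diagonal (no i≢i) = contradiction refl i≢i
  walk⇒pow-pos {suc k} {i} {j} (_∷_ {l = l} e w) =
    subst (0 <_) (sym (entry-⊗ (pow B k) i j))
      (sum-pos⁺ (terms k i j) l (subst (0 <_) (sym (lookup∘tabulate _ l)) (*-mono-< e (walk⇒pow-pos w))))

  pow-pos⇒walk : ∀ k i j → 0 < entry (pow B k) i j → Walk B k i j
  pow-pos⇒walk zero i j p with toℕ i ≟ toℕ j | subst (0 <_) (entry-tabulate _ i j) p
  ... | yes i≡j | _ = subst (Walk B 0 i) (toℕ-injective i≡j) []
  ... | no _    | ()
  pow-pos⇒walk (suc k) i j p =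
    let l , q = sum-pos⁻ (terms k i j) (subst (0 <_) (entry-⊗ (pow B k) i j) p)
        e , w = *-pos⁻ _ _ (subst (0 <_) (lookup∘tabulate _ l) q)
    in  e ∷ pow-pos⇒walk k l j w

  walks-everywhere⇒primitive : ∀ K → 1 ≤ K → (∀ i j → Walk B K i j) → Primitive B
  walks-everywhere⇒primitive K 1≤K walk = K , 1≤K , λ i j → walk⇒pow-pos (walk i j)

parity-suc : ∀ n → parity (suc n) ≡ parity n ⁻¹
parity-suc n = sym (⁻¹-selfInverse (suc-homo-⁻¹ n))

parity≡0ℙ⇒*2 : ∀ m → parity m ≡ 0ℙ → ∃ λ t → t * 2 ≡ m
parity≡0ℙ⇒*2 zero          _  = 0 , refl
parity≡0ℙ⇒*2 (suc (suc m)) pm = let t , eq = parity≡0ℙ⇒*2 m pm in suc t , cong (2 +_) eq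

x+z≡[x+y]+[y+z] : ∀ x y z → x +ℙ z ≡ (x +ℙ y) +ℙ (y +ℙ z)
x+z≡[x+y]+[y+z] 0ℙ 0ℙ 0ℙ = refl
x+z≡[x+y]+[y+z] 0ℙ 0ℙ 1ℙ = refl
x+z≡[x+y]+[y+z] 0ℙ 1ℙ 0ℙ = refl
x+z≡[x+y]+[y+z] 0ℙ 1ℙ 1ℙ = refl
x+z≡[x+y]+[y+z] 1ℙ 0ℙ 0ℙ = refl
x+z≡[x+y]+[y+z] 1ℙ 0ℙ 1ℙ = refl
x+z≡[x+y]+[y+z] 1ℙ 1ℙ 0ℙ = refl
x+z≡[x+y]+[y+z] 1ℙ 1ℙ 1ℙ = refl

≢0ℙ⇒≡1ℙ : ∀ {p} → p ≢ 0ℙ → p ≡ 1ℙ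
≢0ℙ⇒≡1ℙ {0ℙ} p≢0ℙ = contradiction refl p≢0ℙ
≢0ℙ⇒≡1ℙ {1ℙ} _    = refl

[x+y]+y≡x : ∀ x y → (x +ℙ y) +ℙ y ≡ x
[x+y]+y≡x x y = trans (ℙ.+-assoc x y y) (trans (cong (x +ℙ_) (p+p≡0ℙ y)) (ℙ.+-identityʳ x))

Alternating : ∀ {n} → Mat n → Set
Alternating B = ∀ i j → Edge B i j → parity (toℕ i) +ℙ parity (toℕ j) ≡ 1ℙ

module _ {n} {B : Mat n} where

  walk-parity : Alternating B → ∀ {k i j} → Walk B k i j → parity (toℕ i) +ℙ parity (toℕ j) ≡ parity k
  walk-parity alt {i = i} [] = p+p≡0ℙ (parity (toℕ i))
  walk-parity alt {suc k} {i} {j} (_∷_ {l = l} e w) = begin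
    parity (toℕ i) +ℙ parity (toℕ j)
      ≡⟨ x+z≡[x+y]+[y+z] (parity (toℕ i)) (parity (toℕ l)) (parity (toℕ j)) ⟩
    (parity (toℕ i) +ℙ parity (toℕ l)) +ℙ (parity (toℕ l) +ℙ parity (toℕ j))
      ≡⟨ cong₂ _+ℙ_ (alt i l e) (walk-parity alt w) ⟩
    parity k ⁻¹
      ≡⟨ parity-suc k ⟨
    parity (suc k) ∎
    where open ≡-Reasoning

  even-closed-walk : ∀ {ℓ} → Walk B 2 ℓ ℓ → ∀ t → Walk B (t * 2) ℓ ℓ
  even-closed-walk two zero    = []
  even-closed-walk two (suc t) = two ++ʷ even-closed-walk two t

  closed-walk-≥ : ∀ {ℓ c} → Walk B 2 ℓ ℓ → Walk B c ℓ ℓ → parity c ≡ 1ℙ →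
                  ∀ m → c ≤ m → Walk B m ℓ ℓ
  closed-walk-≥ {ℓ} {c} two cyc odd m c≤m with parity m in pm
  ... | 0ℙ = let t , t*2≡m = parity≡0ℙ⇒*2 m pm in
             subst (λ x → Walk B x ℓ ℓ) t*2≡m (even-closed-walk two t)
  ... | 1ℙ = let t , t*2≡m∸c = parity≡0ℙ⇒*2 (m ∸ c) m∸c-even in
             subst (λ x → Walk B x ℓ ℓ) (trans (cong (_+ c) t*2≡m∸c) (m∸n+n≡m c≤m))
                   (even-closed-walk two t ++ʷ cyc)
    where
    m∸c-even : parity (m ∸ c) ≡ 0ℙ
    m∸c-even = ℙ.+-cancelʳ-≡ 1ℙ (parity (m ∸ c)) 0ℙ (begin
      parity (m ∸ c) +ℙ 1ℙ            ≡⟨ cong (parity (m ∸ c) +ℙ_) odd ⟨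
      parity (m ∸ c) +ℙ parity c      ≡⟨ +-homo-+ (m ∸ c) c ⟨
      parity (m ∸ c + c)               ≡⟨ cong parity (m∸n+n≡m c≤m) ⟩
      parity m                         ≡⟨ pm ⟩
      1ℙ                               ∎)
      where open ≡-Reasoning

  hub⇒primitive : (∀ i j → Edge B i j → Edge B j i) → ∀ ℓ D → (∀ u → ∃ λ d → d ≤ D × Walk B d u ℓ) →
                  ∀ {c} → Walk B c ℓ ℓ → parity c ≡ 1ℙ → Primitive B
  hub⇒primitive sym-B ℓ D reach {zero}  cyc         ()
  hub⇒primitive sym-B ℓ D reach {suc c} cyc@(_∷_ {l = x} e _) odd = walks-everywhere⇒primitive K (s≤s z≤n) walk
    where
    K : ℕ
    K = suc c + (D + D)

    walk : ∀ u v → Walk B K u v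
    walk u v with reach u | reach v
    ... | du , du≤D , wu | dv , dv≤D , wv =
      subst (λ x → Walk B x u v) length≡K
        (wu ++ʷ closed-walk-≥ (e ∷ sym-B ℓ x e ∷ []) cyc odd middle 1+c≤middle ++ʷ reverseʷ sym-B wv)
      where
      du+dv≤D+D : du + dv ≤ D + D
      du+dv≤D+D = +-mono-≤ du≤D dv≤D
      middle = K ∸ (du + dv)
      1+c≤middle : suc c ≤ middle
      1+c≤middle = subst (_≤ middle) (m+n∸n≡m (suc c) (D + D)) (∸-monoʳ-≤ K du+dv≤D+D)
      length≡K : du + (middle + dv) ≡ K
      length≡K = begin
        du + (middle + dv)   ≡⟨ x∙yz≈y∙xz du middle dv ⟩
        middle + (du + dv)   ≡⟨ m∸n+n≡m (≤-trans du+dv≤D+D (m≤n+m (D + D) (suc c))) ⟩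
        K                    ∎
        where open ≡-Reasoning

alternating⇒¬primitive : ∀ {m} {B : Mat (suc (suc m))} → Alternating B → ¬ Primitive B
alternating⇒¬primitive alt (k , _ , pos) with parity k in pk
... | 0ℙ = contradiction (trans (walk-parity alt (pow-pos⇒walk k zero (suc zero) (pos _ _))) pk) λ ()
... | 1ℙ = contradiction (trans (walk-parity alt (pow-pos⇒walk k zero zero (pos _ _))) pk) λ ()

ascending-walk : ∀ {n} {B : Mat n} → (∀ {i j} → toℕ j ≡ suc (toℕ i) → Edge B i j) →
                 ∀ d {i j} → toℕ i + d ≡ toℕ j → Walk B d i j
ascending-walk {B = B} step zero {i} i+0≡j =
  subst (Walk B 0 i) (toℕ-injective (trans (sym (+-identityʳ (toℕ i))) i+0≡j)) []
ascending-walk {n} step (suc d) {i} {j} i+1+d≡j =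
  step (toℕ-fromℕ< 1+i<n) ∷ ascending-walk step d (trans (cong (_+ d) (toℕ-fromℕ< 1+i<n)) 1+i+d≡j)
  where
  1+i+d≡j : suc (toℕ i) + d ≡ toℕ j
  1+i+d≡j = trans (sym (+-suc (toℕ i) d)) i+1+d≡j
  1+i<n : suc (toℕ i) < n
  1+i<n = ≤-<-trans (subst (suc (toℕ i) ≤_) 1+i+d≡j (m≤m+n (suc (toℕ i)) d)) (toℕ<n j)

module _ {n} (A : Mat n) where

  entry-F : ∀ i j → entry (F A) i j ≡ entry A i j + entry A j i
  entry-F = entry-tabulate λ i j → entry A i j + entry A j i

  F-symmetric : ∀ i j → Edge (F A) i j → Edge (F A) j i
  F-symmetric i j = subst (0 <_) (trans (entry-F i j) (trans (+-comm (entry A i j) _) (sym (entry-F j i))))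

  F-edge⁺ : ∀ {i j} → Edge A i j → Edge (F A) i j
  F-edge⁺ {i} {j} p = subst (0 <_) (sym (entry-F i j)) (≤-trans p (m≤m+n _ _))

  F-edge⁻ : ∀ {i j} → Edge (F A) i j → Edge A i j ⊎ Edge A j i
  F-edge⁻ {i} {j} p = +-pos⁻ _ _ (subst (0 <_) (entry-F i j) p)

module _ {n} (r : Vec ℕ n) where

  entry-companion : ∀ i j → entry (companion r) i j ≡
    (if ⌊ suc (toℕ i) ≟ n ⌋ then lookup r j else (if ⌊ toℕ j ≟ suc (toℕ i) ⌋ then 1 else 0))
  entry-companion = entry-tabulate λ i j →
    if ⌊ suc (toℕ i) ≟ n ⌋ then lookup r j else (if ⌊ toℕ j ≟ suc (toℕ i) ⌋ then 1 else 0)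

  companion-edge-succ : ∀ {i j} → toℕ j ≡ suc (toℕ i) → Edge (companion r) i j
  companion-edge-succ {i} {j} j≡1+i rewrite entry-companion i j with suc (toℕ i) ≟ n | toℕ j ≟ suc (toℕ i)
  ... | yes 1+i≡n | _        = contradiction (trans j≡1+i 1+i≡n) (<⇒≢ (toℕ<n j))
  ... | no _      | yes _    = z<s
  ... | no _      | no j≢1+i = contradiction j≡1+i j≢1+i

  companion-edge-last : ∀ {i j} → suc (toℕ i) ≡ n → 0 < lookup r j → Edge (companion r) i j
  companion-edge-last {i} {j} 1+i≡n rj>0 rewrite entry-companion i j with suc (toℕ i) ≟ n
  ... | yes _     = rj>0
  ... | no 1+i≢n  = contradiction 1+i≡n 1+i≢n

  companion-edge⁻ : ∀ {i j} → Edge (companion r) i j →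
                    toℕ j ≡ suc (toℕ i) ⊎ (suc (toℕ i) ≡ n × 0 < lookup r j)
  companion-edge⁻ {i} {j} p rewrite entry-companion i j with suc (toℕ i) ≟ n | toℕ j ≟ suc (toℕ i)
  ... | yes 1+i≡n | _        = inj₂ (1+i≡n , p)
  ... | no _      | yes j≡1+i = inj₁ j≡1+i
  ... | no _      | no _     = contradiction p (<-irrefl refl)

companion-lastRow : ∀ {m} (r : Vec ℕ (suc m)) j → entry (companion r) (fromℕ m) j ≡ lookup r j
companion-lastRow {m} r j rewrite entry-companion r (fromℕ m) j with suc (toℕ (fromℕ m)) ≟ suc m
... | yes _ = refl
... | no ℓ≢m = contradiction (cong suc (toℕ-fromℕ m)) ℓ≢m

companion-lastColumn : ∀ {m} {r r' : Vec ℕ (suc m)} → lookup r (fromℕ m) ≡ lookup r' (fromℕ m) →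
                       ∀ j → entry (companion r) j (fromℕ m) ≡ entry (companion r') j (fromℕ m)
companion-lastColumn {m} {r} {r'} rℓ≡r'ℓ j
  rewrite entry-companion r j (fromℕ m) | entry-companion r' j (fromℕ m) with suc (toℕ j) ≟ suc m
... | yes _ = rℓ≡r'ℓ
... | no _  = refl

-- r j ≡ 1 is the edge n-1 — j of F (companion r); with the path j — ⋯ — n-1 it closes a
-- cycle of length n - j (a loop if j = n-1), odd iff n ∸ suc j is even.
HasOddCycle : ∀ {n} → Vec ℕ n → Set
HasOddCycle {n} r = ∃ λ j → lookup r j ≡ 1 × parity (n ∸ suc (toℕ j)) ≡ 0ℙ

hasOddCycle? : ∀ {n} (r : Vec ℕ n) → Dec (HasOddCycle r)
hasOddCycle? {n} r = any? λ j → (lookup r j ≟ 1) ×-dec (parity (n ∸ suc (toℕ j)) ℙ.≟ 0ℙ)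

companion-edge-alternates : ∀ {n} {r : Vec ℕ n} → All Is01 r → ¬ HasOddCycle r →
                            ∀ {i j} → Edge (companion r) i j → parity (toℕ i) +ℙ parity (toℕ j) ≡ 1ℙ
companion-edge-alternates {n} {r} r01 noCycle {i} {j} e with companion-edge⁻ r e
... | inj₁ j≡1+i = begin
  parity (toℕ i) +ℙ parity (toℕ j)         ≡⟨ cong (λ x → parity (toℕ i) +ℙ parity x) j≡1+i ⟩
  parity (toℕ i) +ℙ parity (suc (toℕ i))   ≡⟨ cong (parity (toℕ i) +ℙ_) (parity-suc (toℕ i)) ⟩
  parity (toℕ i) +ℙ parity (toℕ i) ⁻¹      ≡⟨ p+p⁻¹≡1ℙ (parity (toℕ i)) ⟩
  1ℙ                                       ∎
  where open ≡-Reasoning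
... | inj₂ (1+i≡n , rj>0) = begin
  parity (toℕ i) +ℙ parity (toℕ j)                   ≡⟨ cong (λ x → parity x +ℙ parity (toℕ j)) d+j≡i ⟨
  parity (d + toℕ j) +ℙ parity (toℕ j)               ≡⟨ cong (_+ℙ parity (toℕ j)) (+-homo-+ d (toℕ j)) ⟩
  (parity d +ℙ parity (toℕ j)) +ℙ parity (toℕ j)     ≡⟨ [x+y]+y≡x (parity d) (parity (toℕ j)) ⟩
  parity d                                           ≡⟨ ≢0ℙ⇒≡1ℙ (λ d-even → noCycle (j , rj≡1 , d-even)) ⟩
  1ℙ                                                 ∎
  where
  open ≡-Reasoning
  d = n ∸ suc (toℕ j)
  rj≡1 : lookup r j ≡ 1
  rj≡1 with lookup⁺ r01 j
  ... | inj₁ rj≡0 = contradiction (subst (0 <_) rj≡0 rj>0) (<-irrefl refl)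
  ... | inj₂ rj≡1 = rj≡1
  d+j≡i : d + toℕ j ≡ toℕ i
  d+j≡i = trans (cong (λ x → x ∸ suc (toℕ j) + toℕ j) (sym 1+i≡n))
                (m∸n+n≡m (≤-pred (subst (toℕ j <_) (sym 1+i≡n) (toℕ<n j))))

companion-alternating : ∀ {n} {r : Vec ℕ n} → All Is01 r → ¬ HasOddCycle r → Alternating (F (companion r))
companion-alternating {r = r} r01 noCycle i j e with F-edge⁻ (companion r) e
... | inj₁ eᵢⱼ = companion-edge-alternates r01 noCycle eᵢⱼ
... | inj₂ eⱼᵢ = trans (ℙ.+-comm (parity (toℕ i)) _) (companion-edge-alternates r01 noCycle eⱼᵢ)

hasOddCycle⇒primitive : ∀ {m} (r : Vec ℕ (suc m)) → HasOddCycle r → Primitive (F (companion r))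
hasOddCycle⇒primitive {m} r (j , rj≡1 , m∸j-even) =
  hub⇒primitive (F-symmetric A) ℓ m reach (F-edge⁺ A {ℓ} {j} ℓ→j ∷ toLast j) cycle-odd
  where
  A = companion r
  ℓ = fromℕ m

  toLast : ∀ u → Walk (F A) (m ∸ toℕ u) u ℓ
  toLast u = ascending-walk (λ {u} {v} u→v → F-edge⁺ A {u} {v} (companion-edge-succ r u→v)) (m ∸ toℕ u)
               (trans (m+[n∸m]≡n (≤-pred (toℕ<n u))) (sym (toℕ-fromℕ m)))

  reach : ∀ u → ∃ λ d → d ≤ m × Walk (F A) d u ℓ
  reach u = m ∸ toℕ u , m∸n≤m m (toℕ u) , toLast u

  ℓ→j : Edge A ℓ j
  ℓ→j = companion-edge-last r (cong suc (toℕ-fromℕ m)) (subst (0 <_) (sym rj≡1) z<s)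

  cycle-odd : parity (suc (m ∸ toℕ j)) ≡ 1ℙ
  cycle-odd = trans (parity-suc (m ∸ toℕ j)) (cong _⁻¹ m∸j-even)

primitive⇔hasOddCycle : ∀ {m} (r : Vec ℕ (suc (suc m))) → All Is01 r →
                        Primitive (F (companion r)) ⇔ HasOddCycle r
primitive⇔hasOddCycle r r01 = mk⇔ to (hasOddCycle⇒primitive r)
  where
  to : Primitive (F (companion r)) → HasOddCycle r
  to prim with hasOddCycle? r
  ... | yes cycle   = cycle
  ... | no noCycle  =
    contradiction prim (alternating⇒¬primitive {B = F (companion r)} (companion-alternating r01 noCycle))

-- The last row of F (companion r) is r plus the last column of companion r, which depends
-- on r only through r ℓ; and r ℓ is half the diagonal entry at ℓ.
F∘companion-injective : ∀ {m} {r r' : Vec ℕ (suc m)} → F (companion r) ≡ F (companion r') → r ≡ r'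
F∘companion-injective {m} {r} {r'} eq =
  trans (sym (tabulate∘lookup r)) (trans (tabulate-cong rj≡r'j) (tabulate∘lookup r'))
  where
  ℓ = fromℕ m

  lastRow : ∀ (s : Vec ℕ (suc m)) j → entry (F (companion s)) ℓ j ≡ lookup s j + entry (companion s) j ℓ
  lastRow s j = trans (entry-F (companion s) ℓ j) (cong (_+ entry (companion s) j ℓ) (companion-lastRow s j))

  lastRow-eq : ∀ j → lookup r j + entry (companion r) j ℓ ≡ lookup r' j + entry (companion r') j ℓ
  lastRow-eq j = trans (sym (lastRow r j)) (trans (cong (λ B → entry B ℓ j) eq) (lastRow r' j))

  rℓ≡r'ℓ : lookup r ℓ ≡ lookup r' ℓ
  rℓ≡r'ℓ = begin
    lookup r ℓ                           ≡⟨ n≡⌊n+n/2⌋ (lookup r ℓ) ⟩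
    ⌊ lookup r ℓ + lookup r ℓ /2⌋         ≡⟨ cong ⌊_/2⌋ diagonal ⟩
    ⌊ lookup r' ℓ + lookup r' ℓ /2⌋       ≡⟨ n≡⌊n+n/2⌋ (lookup r' ℓ) ⟨
    lookup r' ℓ                          ∎
    where
    open ≡-Reasoning
    diagonal : lookup r ℓ + lookup r ℓ ≡ lookup r' ℓ + lookup r' ℓ
    diagonal = trans (cong (lookup r ℓ +_) (sym (companion-lastRow r ℓ)))
                 (trans (lastRow-eq ℓ) (cong (lookup r' ℓ +_) (companion-lastRow r' ℓ)))

  rj≡r'j : ∀ j → lookup r j ≡ lookup r' j
  rj≡r'j j = +-cancelʳ-≡ (entry (companion r') j ℓ) (lookup r j) (lookup r' j)
    (trans (cong (lookup r j +_) (sym (companion-lastColumn {r = r} {r'} rℓ≡r'ℓ j))) (lastRow-eq j))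

LastIs : ℕ → ∀ {m} → Vec ℕ m → Set
LastIs e {m} w = ∀ i → suc (toℕ i) ≡ m → lookup w i ≡ e

LastIs-∷⁺ : ∀ {e k b} {w : Vec ℕ (suc k)} → LastIs e w → LastIs e (b ∷ w)
LastIs-∷⁺ last (suc i) 1+i≡m = last i (suc-injective 1+i≡m)

LastIs-∷⁻ : ∀ {e k b} {w : Vec ℕ (suc k)} → LastIs e (b ∷ w) → LastIs e w
LastIs-∷⁻ last i 1+i≡m = last (suc i) (cong suc 1+i≡m)

HasOddCycle-∷⁺ : ∀ {m b} {w : Vec ℕ m} → (b ≡ 1 × parity m ≡ 0ℙ) ⊎ HasOddCycle w → HasOddCycle (b ∷ w)
HasOddCycle-∷⁺ (inj₁ (b≡1 , m-even))         = zero , b≡1 , m-even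
HasOddCycle-∷⁺ (inj₂ (j , wj≡1 , cycle-even)) = suc j , wj≡1 , cycle-even

HasOddCycle-∷⁻ : ∀ {m b} {w : Vec ℕ m} → HasOddCycle (b ∷ w) → (b ≡ 1 × parity m ≡ 0ℙ) ⊎ HasOddCycle w
HasOddCycle-∷⁻ (zero  , b≡1 , m-even)      = inj₁ (b≡1 , m-even)
HasOddCycle-∷⁻ (suc j , wj≡1 , cycle-even) = inj₂ (j , wj≡1 , cycle-even)

-- A final entry 1 is a loop at the last vertex.
lastIs1⇒hasOddCycle : ∀ {k} {w : Vec ℕ (suc k)} → LastIs 1 w → HasOddCycle w
lastIs1⇒hasOddCycle {k} last =
  fromℕ k , last (fromℕ k) (cong suc (toℕ-fromℕ k)) ,
  trans (cong (λ x → parity (k ∸ x)) (toℕ-fromℕ k)) (cong parity (n∸n≡0 k))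

module _ {m : ℕ} where

  binaryBranch : List (Vec ℕ m) → List (Vec ℕ m) → List (Vec ℕ (suc m))
  binaryBranch A B = map (0 ∷_) A ++ map (1 ∷_) B

  ∈-binaryBranch⁺ : ∀ {A B b w} → (b ≡ 0 × w ∈ A) ⊎ (b ≡ 1 × w ∈ B) → (b ∷ w) ∈ binaryBranch A B
  ∈-binaryBranch⁺         (inj₁ (refl , w∈A)) = ∈-++⁺ˡ (∈-map⁺ (0 ∷_) w∈A)
  ∈-binaryBranch⁺ {A = A} (inj₂ (refl , w∈B)) = ∈-++⁺ʳ (map (0 ∷_) A) (∈-map⁺ (1 ∷_) w∈B)

  ∈-binaryBranch⁻ : ∀ {A B b w} → (b ∷ w) ∈ binaryBranch A B → (b ≡ 0 × w ∈ A) ⊎ (b ≡ 1 × w ∈ B)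
  ∈-binaryBranch⁻ {A} p with ∈-++⁻ (map (0 ∷_) A) p
  ... | inj₁ q = let _ , v∈A , eq = ∈-map⁻ (0 ∷_) q in
                 inj₁ (∷-injectiveˡ eq , subst (_∈ A) (sym (∷-injectiveʳ eq)) v∈A)
  ... | inj₂ q = let _ , v∈B , eq = ∈-map⁻ (1 ∷_) q in
                 inj₂ (∷-injectiveˡ eq , subst (_∈ _) (sym (∷-injectiveʳ eq)) v∈B)

  binaryBranch-unique : ∀ {A B} → Unique A → Unique B → Unique (binaryBranch A B)
  binaryBranch-unique A! B! = Unique.++⁺ (Unique.map⁺ ∷-injectiveʳ A!) (Unique.map⁺ ∷-injectiveʳ B!) disjoint
    where
    disjoint : ∀ {v} → ¬ (v ∈ map (0 ∷_) _ × v ∈ map (1 ∷_) _)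
    disjoint (p , q) with ∈-map⁻ (0 ∷_) p | ∈-map⁻ (1 ∷_) q
    ... | _ , _ , refl | _ , _ , ()

  length-binaryBranch : ∀ A B → length (binaryBranch A B) ≡ length A + length B
  length-binaryBranch A B =
    trans (length-++ (map (0 ∷_) A)) (cong₂ _+_ (length-map (0 ∷_) A) (length-map (1 ∷_) B))

binaryVecs : ℕ → (k : ℕ) → List (Vec ℕ (suc k))
binaryVecs e zero    = [ e ∷ [] ]
binaryVecs e (suc k) = binaryBranch (binaryVecs e k) (binaryVecs e k)

∈-binaryVecs⁺ : ∀ {e k} {w : Vec ℕ (suc k)} → All Is01 w → LastIs e w → w ∈ binaryVecs e k
∈-binaryVecs⁺ {k = zero}  (_ ∷ [])  last rewrite last zero refl = here refl
∈-binaryVecs⁺ {k = suc k} (inj₁ b≡0 ∷ w01) last =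
  ∈-binaryBranch⁺ (inj₁ (b≡0 , ∈-binaryVecs⁺ w01 (LastIs-∷⁻ last)))
∈-binaryVecs⁺ {k = suc k} (inj₂ b≡1 ∷ w01) last =
  ∈-binaryBranch⁺ (inj₂ (b≡1 , ∈-binaryVecs⁺ w01 (LastIs-∷⁻ last)))

∈-binaryVecs⁻ : ∀ {e k} {w : Vec ℕ (suc k)} → Is01 e → w ∈ binaryVecs e k → All Is01 w × LastIs e w
∈-binaryVecs⁻ {k = zero}  e01 (here refl) = e01 ∷ [] , λ { zero _ → refl }
∈-binaryVecs⁻ {k = suc k} {b ∷ w} e01 p with ∈-binaryBranch⁻ {A = binaryVecs _ k} p
... | inj₁ (b≡0 , w∈) = let w01 , last = ∈-binaryVecs⁻ e01 w∈ in inj₁ b≡0 ∷ w01 , LastIs-∷⁺ last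
... | inj₂ (b≡1 , w∈) = let w01 , last = ∈-binaryVecs⁻ e01 w∈ in inj₂ b≡1 ∷ w01 , LastIs-∷⁺ last

binaryVecs-unique : ∀ e k → Unique (binaryVecs e k)
binaryVecs-unique e zero    = ListAll.[] ∷ []
binaryVecs-unique e (suc k) = binaryBranch-unique (binaryVecs-unique e k) (binaryVecs-unique e k)

length-binaryVecs : ∀ e k → length (binaryVecs e k) ≡ 2 ^ k
length-binaryVecs e zero    = refl
length-binaryVecs e (suc k) = begin
  length (binaryBranch (binaryVecs e k) (binaryVecs e k))   ≡⟨ length-binaryBranch (binaryVecs e k) _ ⟩
  length (binaryVecs e k) + length (binaryVecs e k)         ≡⟨ cong₂ _+_ (length-binaryVecs e k) (length-binaryVecs e k) ⟩
  2 ^ k + 2 ^ k                                             ≡⟨ cong (2 ^ k +_) (+-identityʳ (2 ^ k)) ⟨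
  2 ^ suc k                                                 ∎
  where open ≡-Reasoning

-- The 0/1 vectors of length k + 1 ending in 0 that have an odd cycle, split by the first
-- entry: in length k + 2 a leading 1 closes an odd cycle iff parity (suc k) ≡ 0ℙ, and then
-- every tail is admissible; otherwise the tail must have an odd cycle itself.
mutual
  oddCycleVecs : (k : ℕ) → List (Vec ℕ (suc k))
  oddCycleVecs zero    = []
  oddCycleVecs (suc k) = binaryBranch (oddCycleVecs k) (oddCycleTails (parity (suc k)) k)

  oddCycleTails : Parity → (k : ℕ) → List (Vec ℕ (suc k))
  oddCycleTails 0ℙ k = binaryVecs 0 k
  oddCycleTails 1ℙ k = oddCycleVecs k

OddCycleVec : ∀ {m} → Vec ℕ m → Set
OddCycleVec w = All Is01 w × LastIs 0 w × HasOddCycle w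

∈-oddCycleVecs⁻ : ∀ {k} {w : Vec ℕ (suc k)} → w ∈ oddCycleVecs k → OddCycleVec w
∈-oddCycleVecs⁻ {suc k} {b ∷ w} p with ∈-binaryBranch⁻ {A = oddCycleVecs k} p
... | inj₁ (b≡0 , w∈) = let w01 , last , cycle = ∈-oddCycleVecs⁻ w∈ in
                        inj₁ b≡0 ∷ w01 , LastIs-∷⁺ last , HasOddCycle-∷⁺ (inj₂ cycle)
... | inj₂ (b≡1 , w∈) = afterOne (parity (suc k)) refl w∈
  where
  afterOne : ∀ p → parity (suc k) ≡ p → w ∈ oddCycleTails p k → OddCycleVec (b ∷ w)
  afterOne 0ℙ head-cycle w∈ = let w01 , last = ∈-binaryVecs⁻ (inj₁ refl) w∈ in
                              inj₂ b≡1 ∷ w01 , LastIs-∷⁺ last , HasOddCycle-∷⁺ (inj₁ (b≡1 , head-cycle))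
  afterOne 1ℙ _          w∈ = let w01 , last , cycle = ∈-oddCycleVecs⁻ w∈ in
                              inj₂ b≡1 ∷ w01 , LastIs-∷⁺ last , HasOddCycle-∷⁺ (inj₂ cycle)

∈-oddCycleVecs⁺ : ∀ {k} {w : Vec ℕ (suc k)} → OddCycleVec w → w ∈ oddCycleVecs k
∈-oddCycleVecs⁺ {zero} {b ∷ []} (_ , last , zero , b≡1 , _) = contradiction (trans (sym (last zero refl)) b≡1) λ ()
∈-oddCycleVecs⁺ {suc k} {b ∷ w} (inj₁ refl ∷ w01 , last , cycle) with HasOddCycle-∷⁻ cycle
... | inj₂ w-cycle = ∈-binaryBranch⁺ (inj₁ (refl , ∈-oddCycleVecs⁺ (w01 , LastIs-∷⁻ last , w-cycle)))
∈-oddCycleVecs⁺ {suc k} {b ∷ w} (inj₂ refl ∷ w01 , last , cycle) =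
  ∈-binaryBranch⁺ (inj₂ (refl , afterOne (parity (suc k)) refl))
  where
  afterOne : ∀ p → parity (suc k) ≡ p → w ∈ oddCycleTails p k
  afterOne 0ℙ _ = ∈-binaryVecs⁺ w01 (LastIs-∷⁻ last)
  afterOne 1ℙ head-odd with HasOddCycle-∷⁻ cycle
  ... | inj₁ (_ , head-even) = contradiction (trans (sym head-even) head-odd) λ ()
  ... | inj₂ w-cycle         = ∈-oddCycleVecs⁺ (w01 , LastIs-∷⁻ last , w-cycle)

oddCycleVecs-unique : ∀ k → Unique (oddCycleVecs k)
oddCycleVecs-unique zero    = []
oddCycleVecs-unique (suc k) = binaryBranch-unique (oddCycleVecs-unique k) (tails-unique (parity (suc k)))
  where
  tails-unique : ∀ p → Unique (oddCycleTails p k)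
  tails-unique 0ℙ = binaryVecs-unique 0 k
  tails-unique 1ℙ = oddCycleVecs-unique k

⌈1+n/2⌉≡⌈n/2⌉ : ∀ n → parity (suc n) ≡ 0ℙ → ⌈ suc n /2⌉ ≡ ⌈ n /2⌉
⌈1+n/2⌉≡⌈n/2⌉ (suc zero)    _    = refl
⌈1+n/2⌉≡⌈n/2⌉ (suc (suc n)) even = cong suc (⌈1+n/2⌉≡⌈n/2⌉ n even)

⌈1+n/2⌉≡1+⌈n/2⌉ : ∀ n → parity (suc n) ≡ 1ℙ → ⌈ suc n /2⌉ ≡ suc ⌈ n /2⌉
⌈1+n/2⌉≡1+⌈n/2⌉ zero          _   = refl
⌈1+n/2⌉≡1+⌈n/2⌉ (suc (suc n)) odd = cong suc (⌈1+n/2⌉≡1+⌈n/2⌉ n odd)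

⌈n/2⌉≡⌊n/2⌋ : ∀ n → parity n ≡ 0ℙ → ⌈ n /2⌉ ≡ ⌊ n /2⌋
⌈n/2⌉≡⌊n/2⌋ zero          _    = refl
⌈n/2⌉≡⌊n/2⌋ (suc (suc n)) even = cong suc (⌈n/2⌉≡⌊n/2⌋ n even)

n/2≡⌊n/2⌋ : ∀ n → n / 2 ≡ ⌊ n /2⌋
n/2≡⌊n/2⌋ zero          = refl
n/2≡⌊n/2⌋ (suc zero)    = refl
n/2≡⌊n/2⌋ (suc (suc n)) = trans (m/n≡1+[m∸n]/n {suc (suc n)} {2} (s≤s (s≤s z≤n))) (cong suc (n/2≡⌊n/2⌋ n))

%2≡0⇒parity≡0ℙ : ∀ n → n % 2 ≡ 0 → parity n ≡ 0ℙ
%2≡0⇒parity≡0ℙ zero          _ = refl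
%2≡0⇒parity≡0ℙ (suc (suc n)) p = %2≡0⇒parity≡0ℙ n p

%2≡1⇒parity≡1ℙ : ∀ n → n % 2 ≡ 1 → parity n ≡ 1ℙ
%2≡1⇒parity≡1ℙ (suc zero)    _ = refl
%2≡1⇒parity≡1ℙ (suc (suc n)) p = %2≡1⇒parity≡1ℙ n p

length-oddCycleVecs : ∀ k → length (oddCycleVecs k) + 2 ^ ⌈ k /2⌉ ≡ 2 ^ k
length-oddCycleVecs zero    = refl
length-oddCycleVecs (suc k) with parity (suc k) in pk
... | 0ℙ = begin
  length (binaryBranch L (binaryVecs 0 k)) + 2 ^ ⌈ suc k /2⌉
    ≡⟨ cong₂ _+_ (length-binaryBranch L _) (cong (2 ^_) (⌈1+n/2⌉≡⌈n/2⌉ k pk)) ⟩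
  (length L + length (binaryVecs 0 k)) + 2 ^ ⌈ k /2⌉
    ≡⟨ rearrange (length L) (length (binaryVecs 0 k)) (2 ^ ⌈ k /2⌉) ⟩
  (length L + 2 ^ ⌈ k /2⌉) + (length (binaryVecs 0 k) + 0)
    ≡⟨ cong₂ (λ x y → x + (y + 0)) (length-oddCycleVecs k) (length-binaryVecs 0 k) ⟩
  2 ^ suc k ∎
  where
  open ≡-Reasoning
  L = oddCycleVecs k
  rearrange : ∀ a b c → (a + b) + c ≡ (a + c) + (b + 0)
  rearrange = solve-∀
... | 1ℙ = begin
  length (binaryBranch L L) + 2 ^ ⌈ suc k /2⌉
    ≡⟨ cong₂ _+_ (length-binaryBranch L L) (cong (2 ^_) (⌈1+n/2⌉≡1+⌈n/2⌉ k pk)) ⟩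
  (length L + length L) + 2 * 2 ^ ⌈ k /2⌉
    ≡⟨ rearrange (length L) (2 ^ ⌈ k /2⌉) ⟩
  (length L + 2 ^ ⌈ k /2⌉) + ((length L + 2 ^ ⌈ k /2⌉) + 0)
    ≡⟨ cong (λ x → x + (x + 0)) (length-oddCycleVecs k) ⟩
  2 ^ suc k ∎
  where
  open ≡-Reasoning
  L = oddCycleVecs k
  rearrange : ∀ a c → (a + a) + 2 * c ≡ (a + c) + ((a + c) + 0)
  rearrange = solve-∀

card-InPSC : ∀ {k α e} (S : List (Vec ℕ (suc k))) → Is01 α → Unique S →
             (∀ {w} → w ∈ S → All Is01 w × LastIs e w × HasOddCycle (α ∷ w)) →
             (∀ {w} → All Is01 w → LastIs e w → HasOddCycle (α ∷ w) → w ∈ S) →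
             HasCard (InPSC (suc (suc k)) α e) (length S)
card-InPSC {k} {α} {e} S α01 S-unique S⁻ S⁺ =
  map f S , length-map f S , Unique.map⁺ f-injective S-unique , λ B → mk⇔ (to B) (from B)
  where
  f : Vec ℕ (suc k) → Mat (suc (suc k))
  f w = F (companion (α ∷ w))

  f-injective : ∀ {w w'} → f w ≡ f w' → w ≡ w'
  f-injective eq = ∷-injectiveʳ (F∘companion-injective eq)

  to : ∀ B → InPSC (suc (suc k)) α e B → B ∈ map f S
  to _ ((a ∷ w , a01 ∷ w01 , first , last , refl) , prim) with first zero refl
  ... | refl =
    ∈-map⁺ f (S⁺ w01 (LastIs-∷⁻ last) (Equivalence.to (primitive⇔hasOddCycle (α ∷ w) (a01 ∷ w01)) prim))

  from : ∀ B → B ∈ map f S → InPSC (suc (suc k)) α e B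
  from B B∈ with ∈-map⁻ f B∈
  ... | w , w∈S , refl =
    let w01 , last , cycle = S⁻ w∈S in
    (α ∷ w , α01 ∷ w01 , (λ { zero _ → refl }) , LastIs-∷⁺ last , refl) , hasOddCycle⇒primitive (α ∷ w) cycle

card-InPSC-last1 : ∀ {k α} → Is01 α → HasCard (InPSC (suc (suc k)) α 1) (2 ^ k)
card-InPSC-last1 {k} α01 = subst (HasCard _) (length-binaryVecs 1 k)
  (card-InPSC (binaryVecs 1 k) α01 (binaryVecs-unique 1 k)
    (λ {w} w∈ → let w01 , last = ∈-binaryVecs⁻ (inj₂ refl) w∈ in
                w01 , last , HasOddCycle-∷⁺ (inj₂ (lastIs1⇒hasOddCycle {w = w} last)))
    (λ w01 last _ → ∈-binaryVecs⁺ w01 last))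

card-InPSC-last0-headCycle : ∀ {k} → parity k ≡ 1ℙ → HasCard (InPSC (suc (suc k)) 1 0) (2 ^ k)
card-InPSC-last0-headCycle {k} k-odd = subst (HasCard _) (length-binaryVecs 0 k)
  (card-InPSC (binaryVecs 0 k) (inj₂ refl) (binaryVecs-unique 0 k)
    (λ w∈ → let w01 , last = ∈-binaryVecs⁻ (inj₁ refl) w∈ in
            w01 , last , HasOddCycle-∷⁺ (inj₁ (refl , trans (parity-suc k) (cong _⁻¹ k-odd))))
    (λ w01 last _ → ∈-binaryVecs⁺ w01 last))

HasOddCycle-tail : ∀ {k α} {w : Vec ℕ (suc k)} → α ≡ 0 ⊎ parity k ≡ 0ℙ → HasOddCycle (α ∷ w) → HasOddCycle w
HasOddCycle-tail noHeadCycle cycle with HasOddCycle-∷⁻ cycle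
HasOddCycle-tail     _             _ | inj₂ w-cycle        = w-cycle
HasOddCycle-tail     (inj₁ refl)   _ | inj₁ (() , _)
HasOddCycle-tail {k} (inj₂ k-even) _ | inj₁ (_ , 1+k-even) =
  contradiction (trans (sym 1+k-even) (trans (parity-suc k) (cong _⁻¹ k-even))) λ ()

card-InPSC-last0-noHeadCycle : ∀ {k α} → Is01 α → α ≡ 0 ⊎ parity k ≡ 0ℙ →
                               HasCard (InPSC (suc (suc k)) α 0) (2 ^ k ∸ 2 ^ ⌈ k /2⌉)
card-InPSC-last0-noHeadCycle {k} {α} α01 noHeadCycle =
  subst (HasCard (InPSC (suc (suc k)) α 0)) length≡
  (card-InPSC (oddCycleVecs k) α01 (oddCycleVecs-unique k)
    (λ w∈ → let w01 , last , cycle = ∈-oddCycleVecs⁻ w∈ in w01 , last , HasOddCycle-∷⁺ (inj₂ cycle))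
    (λ w01 last cycle → ∈-oddCycleVecs⁺ (w01 , last , HasOddCycle-tail noHeadCycle cycle)))
  where
  length≡ : length (oddCycleVecs k) ≡ 2 ^ k ∸ 2 ^ ⌈ k /2⌉
  length≡ = trans (sym (m+n∸n≡m _ (2 ^ ⌈ k /2⌉))) (cong (_∸ 2 ^ ⌈ k /2⌉) (length-oddCycleVecs k))

theorem1 : (n : ℕ) → 4 ≤ n →
    ((α : ℕ) → α ≡ 0 ⊎ α ≡ 1 → HasCard (InPSC n α 1) (2 ^ (n ∸ 2)))
    × (n % 2 ≡ 1 → HasCard (InPSC n 1 0) (2 ^ (n ∸ 2)))
    × (n % 2 ≡ 0 → HasCard (InPSC n 1 0) (2 ^ (n ∸ 2) ∸ 2 ^ ((n ∸ 2) / 2)))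
    × HasCard (InPSC n 0 0) (2 ^ (n ∸ 2) ∸ 2 ^ ((n ∸ 1) / 2))
theorem1 (suc (suc k)) (s≤s (s≤s _)) =
    (λ α α01 → card-InPSC-last1 α01)
  , (λ n-odd → card-InPSC-last0-headCycle (%2≡1⇒parity≡1ℙ k n-odd))
  , (λ n-even → let k-even = %2≡0⇒parity≡0ℙ k n-even in
       subst (λ h → HasCard (InPSC (suc (suc k)) 1 0) (2 ^ k ∸ 2 ^ h))
             (trans (⌈n/2⌉≡⌊n/2⌋ k k-even) (sym (n/2≡⌊n/2⌋ k)))
             (card-InPSC-last0-noHeadCycle (inj₂ refl) (inj₂ k-even)))
  , subst (λ h → HasCard (InPSC (suc (suc k)) 0 0) (2 ^ k ∸ 2 ^ h)) (sym (n/2≡⌊n/2⌋ (suc k)))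
          (card-InPSC-last0-noHeadCycle (inj₁ refl) (inj₁ refl))
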